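{- Let $M$ be a finite LTS and $B\subseteq\mathit{Act}$. Every finite path of $M$ can be extended to a path of $M$ that satisfies strong $B$-hyperfairness of actions (i.e., strong $B$-hyperfairness of actions is feasible).
   Context: LTS $M=(S,s_{init},\mathit{Act},\mathit{Trans})$ with $S$ and $\mathit{Act}$ finite. Paths: alternating sequences $s_0t_1s_1\dots$ starting in a state, infinite or ending in a state, consecutive; a path $\pi'$ extends a finite path $\pi$ if $\pi$ is a prefix of $\pi'$. An action occurs on a path if a transition on it carries that label; $\alpha$-free = no action of $\alpha$ occurs. An action is enabled in $s$ if a transition with that label leaves $s$. $\overline{B}=\mathit{Act}\setminus B$. A state $s$ is $B$-reachable from $s'$ if some $B$-free path from $s'$ ends in $s$; an action $a$ is $B$-reachable from $s$ if it is enabled in some state $B$-reachable from $s$; $a$ is relentlessly $B$-reachable on a path if every suffix of it contains a state from which $a$ is $B$-reachable. A path $\pi$ satisfies strong $B$-hyperfairness of actions iff for every suffix $\pi'$ of $\pi$, every $a\in\overline{B}$ relentlessly $B$-reachable in $\pi'$ occurs in $\pi'$. -}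

module Defs where

open import Data.Nat using (ℕ; zero; suc; _≤_; _<_)
open import Data.Fin using (Fin)
open import Data.Fin.Subset using (Subset; _∈_; _∉_)
open import Data.Bool using (Bool; T)
open import Data.Maybe using (Maybe; just; nothing)
open import Data.Unit using (⊤)
open import Data.Product using (Σ; ∃; ∃-syntax; _×_; _,_)
open import Relation.Binary.PropositionalEquality using (_≡_)

record LTS : Set where
  field
    nS    : ℕ
    nA    : ℕ
    sinit : Fin nS
    trans : Fin nS → Fin nA → Fin nS → Bool

module _ (M : LTS) where
  open LTS M

  State = Fin nS
  Action = Fin nA

  -- Length of a path: just n = finite path with n transitions (states s_0..s_n),
  -- nothing = infinite path.
  Len : Set
  Len = Maybe ℕ

  StIdx : Len → ℕ → Set
  StIdx (just n) i = i ≤ n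
  StIdx nothing  i = ⊤

  -- i is a transition index (transition t_{i+1} from s_i to s_{i+1})
  TrIdx : Len → ℕ → Set
  TrIdx (just n) i = i < n
  TrIdx nothing  i = ⊤

  -- A path s_0 t_1 s_1 ... : st i = s_i, act i = label of t_{i+1};
  -- values outside the index range are irrelevant.
  record Path : Set where
    field
      len   : Len
      st    : ℕ → State
      act   : ℕ → Action
      valid : ∀ i → TrIdx len i → T (trans (st i) (act i) (st (suc i)))
  open Path public

  Finite : Path → Set
  Finite π = ∃[ n ] len π ≡ just n

  Extends : Path → Path → Set
  Extends π' π =
    ∃[ n ] (len π ≡ just n)
      × (∀ i → i ≤ n → StIdx (len π') i × st π' i ≡ st π i)
      × (∀ i → i < n → act π' i ≡ act π i)

  -- an action of α occurs on π at some transition index ≥ k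
  -- (i.e. on the suffix of π starting at state s_k)
  OccursFrom : Path → ℕ → Action → Set
  OccursFrom π k a = ∃[ i ] k ≤ i × TrIdx (len π) i × act π i ≡ a

  Free : Subset nA → Path → Set
  Free B π = ∀ i → TrIdx (len π) i → act π i ∉ B

  StateBReachable : Subset nA → State → State → Set
  StateBReachable B s' s =
    Σ Path λ π → Σ ℕ λ n → len π ≡ just n × Free B π × st π 0 ≡ s' × st π n ≡ s

  Enabled : Action → State → Set
  Enabled a s = ∃[ t ] T (trans s a t)

  ActBReachable : Subset nA → State → Action → Set
  ActBReachable B s a = ∃[ s₁ ] StateBReachable B s s₁ × Enabled a s₁

  RelentlesslyFrom : Subset nA → Path → ℕ → Action → Set
  RelentlesslyFrom B π k a =
    ∀ j → k ≤ j → StIdx (len π) j →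
      ∃[ l ] j ≤ l × StIdx (len π) l × ActBReachable B (st π l) a

  StrongHyperfair : Subset nA → Path → Set
  StrongHyperfair B π =
    ∀ k → StIdx (len π) k → ∀ a → a ∉ B →
      RelentlesslyFrom B π k a → OccursFrom π k a

{-# OPTIONS --safe #-}
-- Walk without B-actions to a state s★ that is settled for every action a: either a
-- is B-reachable from every state B-reachable from s★, or from none of them. Actions
-- are settled one at a time, since walking further keeps settled actions settled.
-- If no action outside B is B-reachable from s★, stop there. Otherwise run forever
-- in rounds, each walking to and firing every action outside B that is B-reachable
-- from s★. Every state of the run is B-reachable from s★, so by settledness an action
-- relentlessly B-reachable on a suffix is one of these and is fired in every round.
-- Hyperfairness concerns suffixes only, so it survives prepending the given finite
-- path. B-reachability is decidable since the layers of states reachable within k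
-- steps stop growing by k = |S|.
module Submission where

open import Defs
open import Data.Bool using (T)
open import Data.Empty using (⊥-elim)
open import Data.Fin using (Fin; toℕ; _≟_)
open import Data.Fin.Properties using (any?; pigeonhole; toℕ≤pred[n])
open import Data.Fin.Subset using (Subset; _∉_)
open import Data.Fin.Subset.Properties using (_∈?_)
open import Data.List using (List; []; _∷_; allFin; filter)
open import Data.List.Membership.Propositional using (_∈_)
open import Data.List.Membership.Propositional.Properties using (∈-allFin; ∈-filter⁺)
open import Data.List.Relation.Unary.All as All using (All; []; _∷_)
open import Data.List.Relation.Unary.All.Properties using (all-filter)
open import Data.List.Relation.Unary.Any using (here; there)
open import Data.Maybe as Maybe using (just; nothing)
open import Data.Nat using (ℕ; zero; suc; pred; _+_; _≤_; _<_; _≤′_; ≤′-refl; ≤′-step; z≤n; s≤s; s≤s⁻¹; z<s)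
open import Data.Nat.GeneralisedArithmetic using (iterate)
open import Data.Nat.Properties using (≤-refl; m≤m+n; ≤⇒≤′; n<1+n)
open import Data.Product using (Σ; ∃; ∃-syntax; _×_; _,_; proj₁; proj₂)
open import Data.Sum using (_⊎_; inj₁; inj₂)
open import Data.Unit using (tt)
open import Function using (_∘_)
open import Level using (0ℓ)
open import Relation.Binary using (Rel; Decidable)
open import Relation.Binary.Construct.Closure.ReflexiveTransitive using (Star; ε; _◅_; _◅◅_; return)
open import Relation.Binary.PropositionalEquality using (_≡_; refl; sym; cong; subst) renaming (trans to ≡-trans)
open import Relation.Nullary using (¬_; Dec; yes; no)
open import Relation.Nullary.Decidable using (map′; decidable-stable; _×-dec_; _⊎-dec_; ¬?; T?)
open import Relation.Unary using (Pred)

iterate-suc : ∀ {A : Set} (f : A → A) x n → iterate f x (suc n) ≡ f (iterate f x n)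
iterate-suc f x zero    = refl
iterate-suc f x (suc n) = iterate-suc f (f x) n

iterate-+ : ∀ {A : Set} (f : A → A) x m n → iterate f x (m + n) ≡ iterate f (iterate f x m) n
iterate-+ f x zero    n = refl
iterate-+ f x (suc m) n = iterate-+ f (f x) m n

module FiniteReachability {n} {_⟶_ : Rel (Fin n) 0ℓ} (_⟶?_ : Decidable _⟶_) (s : Fin n) where

  Layer : ℕ → Pred (Fin n) 0ℓ
  Layer zero    t = s ≡ t
  Layer (suc k) t = Layer k t ⊎ ∃[ u ] Layer k u × u ⟶ t

  layer? : ∀ k t → Dec (Layer k t)
  layer? zero    t = s ≟ t
  layer? (suc k) t = layer? k t ⊎-dec any? λ u → layer? k u ×-dec u ⟶? t

  layer⇒star : ∀ {k t} → Layer k t → Star _⟶_ s t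
  layer⇒star {zero}  refl               = ε
  layer⇒star {suc k} (inj₁ l)           = layer⇒star l
  layer⇒star {suc k} (inj₂ (_ , l , e)) = layer⇒star l ◅◅ return e

  layer-mono′ : ∀ {k m t} → k ≤′ m → Layer k t → Layer m t
  layer-mono′ ≤′-refl       l = l
  layer-mono′ (≤′-step k≤m) l = inj₁ (layer-mono′ k≤m l)

  layer-mono : ∀ {k m t} → k ≤ m → Layer k t → Layer m t
  layer-mono = layer-mono′ ∘ ≤⇒≤′

  Saturated : ℕ → Set
  Saturated k = ∀ t → Layer (suc k) t → Layer k t

  saturated-suc : ∀ {k} → Saturated k → Saturated (suc k)
  saturated-suc sat t (inj₁ l)           = l
  saturated-suc sat t (inj₂ (u , l , e)) = inj₂ (u , sat u l , e)

  saturated-mono′ : ∀ {k m} → k ≤′ m → Saturated k → Saturated m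
  saturated-mono′ ≤′-refl       sat = sat
  saturated-mono′ (≤′-step k≤m) sat = saturated-suc (saturated-mono′ k≤m sat)

  saturated-mono : ∀ {k m} → k ≤ m → Saturated k → Saturated m
  saturated-mono = saturated-mono′ ∘ ≤⇒≤′

  New : ℕ → Pred (Fin n) 0ℓ
  New k t = Layer (suc k) t × ¬ Layer k t

  unsaturated⇒new : ∀ {k} → ¬ Saturated k → ∃ (New k)
  unsaturated⇒new {k} ¬sat with any? (λ t → layer? (suc k) t ×-dec ¬? (layer? k t))
  ... | yes new = new
  ... | no ¬new = ⊥-elim (¬sat λ t l → decidable-stable (layer? k t) λ ¬l → ¬new (t , l , ¬l))

  new-disjoint : ∀ {i j t} → i < j → New i t → ¬ New j t
  new-disjoint i<j (l , _) (_ , ¬l) = ¬l (layer-mono i<j l)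

  -- Layers 0 … n growing strictly would yield n + 1 distinct new vertices.
  some-layer-saturated : ¬ (∀ k → k ≤ n → ¬ Saturated k)
  some-layer-saturated unsat =
    let (i , j , i<j , same) = pigeonhole (n<1+n n) (proj₁ ∘ new)
    in new-disjoint i<j (proj₂ (new i)) (subst (New (toℕ j)) (sym same) (proj₂ (new j)))
    where
    new : (k : Fin (suc n)) → ∃ (New (toℕ k))
    new k = unsaturated⇒new (unsat (toℕ k) (toℕ≤pred[n] k))

  saturated : Saturated n
  saturated t l = decidable-stable (layer? n t) λ ¬l →
    some-layer-saturated λ k k≤n sat → ¬l (saturated-mono k≤n sat t l)

  star⇒layer : ∀ {u t} → Layer n u → Star _⟶_ u t → Layer n t
  star⇒layer l ε       = l
  star⇒layer l (e ◅ w) = star⇒layer (saturated _ (inj₂ (_ , l , e))) w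

  star? : ∀ t → Dec (Star _⟶_ s t)
  star? t = map′ layer⇒star (star⇒layer (layer-mono z≤n refl)) (layer? n t)

PathFrom : (M : LTS) → State M → Set
PathFrom M s = Σ (Path M) λ ρ → st ρ 0 ≡ s

module _ {M : LTS} where
  open LTS M using (trans)

  StIdx-zero : ∀ L → StIdx M L 0
  StIdx-zero (just _) = z≤n
  StIdx-zero nothing  = tt

  StIdx-suc : ∀ L {i} → StIdx M L i → StIdx M (Maybe.map suc L) (suc i)
  StIdx-suc (just _) = s≤s
  StIdx-suc nothing  = _

  StIdx-pred : ∀ L {i} → StIdx M (Maybe.map suc L) i → StIdx M L (pred i)
  StIdx-pred (just _) {zero}  _ = z≤n
  StIdx-pred (just _) {suc i}   = s≤s⁻¹
  StIdx-pred nothing            = _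

  TrIdx-suc : ∀ L {i} → TrIdx M L i → TrIdx M (Maybe.map suc L) (suc i)
  TrIdx-suc (just _) = s≤s
  TrIdx-suc nothing  = _

  TrIdx-pred : ∀ L {i} → TrIdx M (Maybe.map suc L) (suc i) → TrIdx M L i
  TrIdx-pred (just _) = s≤s⁻¹
  TrIdx-pred nothing  = _

  cons : ∀ {s a u} → T (trans s a u) → PathFrom M u → PathFrom M s
  cons {s} {a} t (ρ , ρ₀) = record
    { len   = Maybe.map suc (len ρ)
    ; st    = λ { zero → s ; (suc i) → st ρ i }
    ; act   = λ { zero → a ; (suc i) → act ρ i }
    ; valid = λ { zero _ → subst (T ∘ trans s a) (sym ρ₀) t
                ; (suc i) i<n → valid ρ i (TrIdx-pred (len ρ) i<n) }
    } , refl

  trIdx : (π : Path M) {n i : ℕ} → len π ≡ just n → i < n → TrIdx M (len π) i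
  trIdx π eq i<n = subst (λ L → TrIdx M L _) (sym eq) i<n

  tail : (π : Path M) {n : ℕ} → len π ≡ just (suc n) → Path M
  tail π {n} eq = record
    { len   = just n
    ; st    = st π ∘ suc
    ; act   = act π ∘ suc
    ; valid = λ i i<n → valid π (suc i) (trIdx π eq (s≤s i<n))
    }

  first-transition : (π : Path M) {n : ℕ} → len π ≡ just (suc n) →
                     T (trans (st π 0) (act π 0) (st π 1))
  first-transition π eq = valid π 0 (trIdx π eq z<s)

  append : (π : Path M) {n : ℕ} → len π ≡ just n → PathFrom M (st π n) → PathFrom M (st π 0)
  append π {zero}  eq ρ = ρ
  append π {suc n} eq ρ = cons (first-transition π eq) (append (tail π eq) refl ρ)

  cons-extends : (π : Path M) {n : ℕ} (eq : len π ≡ just (suc n))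
                 (t : T (trans (st π 0) (act π 0) (st π 1))) (ρ : PathFrom M (st π 1)) →
                 Extends M (proj₁ ρ) (tail π eq) → Extends M (proj₁ (cons t ρ)) π
  cons-extends π {n} eq t ρ (_ , refl , sts , acts) = suc n , eq , sts′ , acts′
    where
    sts′ : ∀ i → i ≤ suc n →
           StIdx M (len (proj₁ (cons t ρ))) i × st (proj₁ (cons t ρ)) i ≡ st π i
    sts′ zero    _         = StIdx-zero _ , refl
    sts′ (suc i) (s≤s i≤n) = let (idx , same) = sts i i≤n in StIdx-suc _ idx , same
    acts′ : ∀ i → i < suc n → act (proj₁ (cons t ρ)) i ≡ act π i
    acts′ zero    _         = refl
    acts′ (suc i) (s≤s i<n) = acts i i<n

  append-extends : (π : Path M) {n : ℕ} (eq : len π ≡ just n) (ρ : PathFrom M (st π n)) →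
                   Extends M (proj₁ (append π eq ρ)) π
  append-extends π {zero}  eq (ρ , ρ₀) =
    0 , eq , (λ { zero z≤n → StIdx-zero (len ρ) , ρ₀ }) , λ _ ()
  append-extends π {suc n} eq ρ =
    cons-extends π eq (first-transition π eq) (append (tail π eq) refl ρ)
                 (append-extends (tail π eq) refl ρ)

module _ {M : LTS} {B : Subset (LTS.nA M)} where
  open LTS M using (trans)

  private
    pred-≤ : ∀ {k j} → pred k ≤ j → k ≤ suc j
    pred-≤ {zero}  _ = z≤n
    pred-≤ {suc k}   = s≤s

  module _ {s a u} (t : T (trans s a u)) (ρ : PathFrom M u) where

    relentless-cons : ∀ {k b} → RelentlesslyFrom M B (proj₁ (cons t ρ)) k b →
                      RelentlesslyFrom M B (proj₁ ρ) (pred k) b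
    relentless-cons rel j k≤j j-idx with rel (suc j) (pred-≤ k≤j) (StIdx-suc _ j-idx)
    ... | suc l , s≤s j≤l , l-idx , reach = l , j≤l , StIdx-pred _ l-idx , reach

    occurs-cons : ∀ {k b} → OccursFrom M (proj₁ ρ) (pred k) b →
                  OccursFrom M (proj₁ (cons t ρ)) k b
    occurs-cons (i , k≤i , i-idx , same) = suc i , pred-≤ k≤i , TrIdx-suc _ i-idx , same

    cons-hyperfair : StrongHyperfair M B (proj₁ ρ) → StrongHyperfair M B (proj₁ (cons t ρ))
    cons-hyperfair fair k k-idx b b∉B rel =
      occurs-cons (fair (pred k) (StIdx-pred _ k-idx) b b∉B (relentless-cons rel))

  append-hyperfair : (π : Path M) {n : ℕ} (eq : len π ≡ just n) (ρ : PathFrom M (st π n)) →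
                     StrongHyperfair M B (proj₁ ρ) → StrongHyperfair M B (proj₁ (append π eq ρ))
  append-hyperfair π {zero}  eq ρ fair = fair
  append-hyperfair π {suc n} eq ρ fair =
    cons-hyperfair (first-transition π eq) (append (tail π eq) refl ρ)
                   (append-hyperfair (tail π eq) refl ρ fair)

module _ {M : LTS} (B : Subset (LTS.nA M)) where
  open LTS M using (nA; trans)

  Step : Rel (State M) 0ℓ
  Step s t = ∃[ a ] a ∉ B × T (trans s a t)

  Walk : Rel (State M) 0ℓ
  Walk = Star Step

  step? : Decidable Step
  step? s t = any? λ a → ¬? (a ∈? B) ×-dec T? (trans s a t)

  walk? : Decidable Walk
  walk? s = FiniteReachability.star? step? s

  Reachable : State M → Action M → Set
  Reachable s a = ∃[ t ] Walk s t × Enabled M a t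

  reachable? : ∀ s a → Dec (Reachable s a)
  reachable? s a = any? λ t → walk? s t ×-dec any? λ u → T? (trans t a u)

  reachable-◅◅ : ∀ {s u a} → Walk s u → Reachable u a → Reachable s a
  reachable-◅◅ w (t , w′ , e) = t , w ◅◅ w′ , e

  free-walk : (π : Path M) {n : ℕ} → len π ≡ just n → Free M B π → Walk (st π 0) (st π n)
  free-walk π {zero}  eq free = ε
  free-walk π {suc n} eq free =
    (act π 0 , free 0 (trIdx π eq z<s) , first-transition π eq) ◅
    free-walk (tail π eq) refl λ i i<n → free (suc i) (trIdx π eq (s≤s i<n))

  ActBReachable⇒Reachable : ∀ {s a} → ActBReachable M B s a → Reachable s a
  ActBReachable⇒Reachable (t , (π , n , eq , free , refl , refl) , e) = t , free-walk π eq free , e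

  _◅◅ₚ_ : ∀ {s u} → Walk s u → PathFrom M u → PathFrom M s
  ε               ◅◅ₚ ρ = ρ
  ((_ , _ , t) ◅ w) ◅◅ₚ ρ = cons t (w ◅◅ₚ ρ)

  ◅◅ₚ-hyperfair : ∀ {s u} (w : Walk s u) (ρ : PathFrom M u) →
                 StrongHyperfair M B (proj₁ ρ) → StrongHyperfair M B (proj₁ (w ◅◅ₚ ρ))
  ◅◅ₚ-hyperfair ε                 ρ fair = fair
  ◅◅ₚ-hyperfair ((_ , _ , t) ◅ w) ρ fair = cons-hyperfair t (w ◅◅ₚ ρ) (◅◅ₚ-hyperfair w ρ fair)

  Settled : State M → Action M → Set
  Settled s a = (∀ {t} → Walk s t → Reachable t a) ⊎ (∀ {t} → Walk s t → ¬ Reachable t a)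

  settled-◅◅ : ∀ {s u a} → Walk s u → Settled s a → Settled u a
  settled-◅◅ w (inj₁ always) = inj₁ (always ∘ (w ◅◅_))
  settled-◅◅ w (inj₂ never)  = inj₂ (never ∘ (w ◅◅_))

  settled-reachable : ∀ {s v a} → Settled s a → Reachable s a → Walk s v → Reachable v a
  settled-reachable (inj₁ always) _ w = always w
  settled-reachable (inj₂ never)  r _ = ⊥-elim (never ε r)

  settled-origin : ∀ {s v a} → Settled s a → Walk s v → Reachable v a → Reachable s a
  settled-origin (inj₁ always) _ _ = always ε
  settled-origin (inj₂ never)  w r = ⊥-elim (never w r)

  settle : ∀ s a → ∃[ t ] Walk s t × Settled t a
  settle s a with any? (λ t → walk? s t ×-dec ¬? (reachable? t a))
  ... | yes (t , w , ¬r) = t , w , inj₂ λ w′ r → ¬r (reachable-◅◅ w′ r)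
  ... | no ¬escape       = s , ε , inj₁ λ {t} w →
    decidable-stable (reachable? t a) λ ¬r → ¬escape (t , w , ¬r)

  settle-all : (as : List (Action M)) → ∀ s → ∃[ t ] Walk s t × All (Settled t) as
  settle-all []       s = s , ε , []
  settle-all (a ∷ as) s =
    let (u , w , settled) = settle-all as s
        (t , w′ , settledₐ) = settle u a
    in t , w ◅◅ w′ , settledₐ ∷ All.map (settled-◅◅ w′) settled

  Obligation : State M → Action M → Set
  Obligation s a = a ∉ B × Reachable s a

  obligation? : ∀ s a → Dec (Obligation s a)
  obligation? s a = ¬? (a ∈? B) ×-dec reachable? s a

  trivial-path : Action M → (s : State M) → PathFrom M s
  trivial-path a s = record { len = just 0 ; st = λ _ → s ; act = λ _ → a ; valid = λ _ () } , refl

  trivial-path-hyperfair : ∀ {a s} → (∀ b → ¬ Obligation s b) →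
                           StrongHyperfair M B (proj₁ (trivial-path a s))
  trivial-path-hyperfair none k k≤0 b b∉B rel =
    let (_ , _ , _ , reach) = rel k ≤-refl k≤0
    in ⊥-elim (none b (b∉B , ActBReachable⇒Reachable reach))

  module Scheduler {s★ : State M} (settled : ∀ a → Settled s★ a)
                   {a₀ : Action M} (oblig₀ : Obligation s★ a₀) where

    data Plan : State M → Set where
      [_] : ∀ {s t} → Step s t → Plan s
      _∷_ : ∀ {s t} → Step s t → Plan t → Plan s

    labels : ∀ {s} → Plan s → List (Action M)
    labels [ x ]   = proj₁ x ∷ []
    labels (x ∷ p) = proj₁ x ∷ labels p

    _◅◅ᴾ_ : ∀ {s u} → Walk s u → Plan u → Plan s
    ε       ◅◅ᴾ p = p
    (x ◅ w) ◅◅ᴾ p = x ∷ (w ◅◅ᴾ p)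

    ∈-◅◅ᴾ : ∀ {s u a} (w : Walk s u) {p : Plan u} → a ∈ labels p → a ∈ labels (w ◅◅ᴾ p)
    ∈-◅◅ᴾ ε       a∈p = a∈p
    ∈-◅◅ᴾ (_ ◅ w) a∈p = there (∈-◅◅ᴾ w a∈p)

    approach : ∀ {a v} → Obligation s★ a → Walk s★ v → Reachable v a
    approach {a} (_ , reach) = settled-reachable (settled a) reach

    -- Every round ends by firing a₀, which makes every plan non-empty.
    round : (as : List (Action M)) → All (Obligation s★) as → ∀ {v} → Walk s★ v → Plan v
    round [] [] r =
      let (_ , w , _ , t) = approach oblig₀ r
      in w ◅◅ᴾ [ a₀ , proj₁ oblig₀ , t ]
    round (a ∷ as) (oblig ∷ obligs) r =
      let (_ , w , _ , t) = approach oblig r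
          x = a , proj₁ oblig , t
      in w ◅◅ᴾ (x ∷ round as obligs (r ◅◅ w ◅◅ return x))

    ∈-round : ∀ {a} as obligs {v} (r : Walk s★ v) → a ∈ as → a ∈ labels (round as obligs r)
    ∈-round (_ ∷ _)  (oblig ∷ _)      r (here refl) with approach oblig r
    ... | _ , w , _ = ∈-◅◅ᴾ w (here refl)
    ∈-round (_ ∷ as) (oblig ∷ obligs) r (there a∈as) with approach oblig r
    ... | _ , w , _ = ∈-◅◅ᴾ w (there (∈-round as obligs _ a∈as))

    obligations : List (Action M)
    obligations = filter (obligation? s★) (allFin nA)

    full-round : ∀ {v} → Walk s★ v → Plan v
    full-round = round obligations (all-filter (obligation? s★) (allFin nA))

    ∈-full-round : ∀ {a v} (r : Walk s★ v) → Obligation s★ a → a ∈ labels (full-round r)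
    ∈-full-round {a} r oblig =
      ∈-round obligations _ r (∈-filter⁺ (obligation? s★) (∈-allFin a) oblig)

    record Config : Set where
      constructor config
      field
        {state} : State M
        reached : Walk s★ state
        plan    : Plan state
    open Config

    next : Config → Config
    next (config r [ x ]) = config (r ◅◅ return x) (full-round (r ◅◅ return x))
    next (config r (x ∷ p)) = config (r ◅◅ return x) p

    emitted : Config → Action M
    emitted (config _ [ x ])   = proj₁ x
    emitted (config _ (x ∷ _)) = proj₁ x

    emitted-valid : (c : Config) → T (trans (state c) (emitted c) (state (next c)))
    emitted-valid (config _ [ _ , _ , t ])     = t
    emitted-valid (config _ ((_ , _ , t) ∷ _)) = t

    Eventually : Config → Action M → Set
    Eventually c a = ∃[ d ] emitted (iterate next c d) ≡ a

    eventually-planned : ∀ {a v} (r : Walk s★ v) (p : Plan v) → a ∈ labels p →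
                         Eventually (config r p) a
    eventually-planned r [ _ ]   (here refl)  = 0 , refl
    eventually-planned r (_ ∷ _) (here refl)  = 0 , refl
    eventually-planned r (x ∷ p) (there a∈p) =
      let (d , emits) = eventually-planned (r ◅◅ return x) p a∈p in suc d , emits

    eventually-obliged : ∀ {a v} → Obligation s★ a → (r : Walk s★ v) (p : Plan v) →
                         Eventually (config r p) a
    eventually-obliged oblig r [ x ] =
      let (d , emits) = eventually-planned _ _ (∈-full-round (r ◅◅ return x) oblig)
      in suc d , emits
    eventually-obliged oblig r (x ∷ p) =
      let (d , emits) = eventually-obliged oblig (r ◅◅ return x) p in suc d , emits

    run : ℕ → Config
    run = iterate next (config ε (full-round ε))

    path : PathFrom M s★
    path = record
      { len   = nothing
      ; st    = state ∘ run
      ; act   = emitted ∘ run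
      ; valid = λ i _ → subst (T ∘ trans (state (run i)) (emitted (run i)) ∘ state)
                          (sym (iterate-suc next _ i)) (emitted-valid (run i))
      } , refl

    path-hyperfair : StrongHyperfair M B (proj₁ path)
    path-hyperfair k _ a a∉B rel =
      let (l , _ , _ , reach) = rel k ≤-refl tt
          oblig = a∉B , settled-origin (settled a) (reached (run l))
                                       (ActBReachable⇒Reachable reach)
          (d , emits) = eventually-obliged oblig (reached (run k)) (plan (run k))
      in k + d , m≤m+n k d , tt , ≡-trans (cong emitted (iterate-+ next _ k d)) emits

  settled-hyperfair-path : ∀ {s} → Action M → (∀ a → Settled s a) →
                           Σ (PathFrom M s) (StrongHyperfair M B ∘ proj₁)
  settled-hyperfair-path {s} a settled with any? (obligation? s)
  ... | yes (a₀ , oblig₀) =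
    Scheduler.path settled oblig₀ , Scheduler.path-hyperfair settled oblig₀
  ... | no none           = trivial-path a s , trivial-path-hyperfair λ b oblig → none (b , oblig)

  -- The action is only a filler for act beyond the end of a finite path.
  hyperfair-path : Action M → ∀ s → Σ (PathFrom M s) (StrongHyperfair M B ∘ proj₁)
  hyperfair-path a s =
    let (_ , w , settled) = settle-all (allFin nA) s
        (ρ , fair) = settled-hyperfair-path a (All.lookup settled ∘ ∈-allFin)
    in w ◅◅ₚ ρ , ◅◅ₚ-hyperfair w ρ fair

proposition38 : (M : LTS) (B : Subset (LTS.nA M)) (π : Path M) →
    Finite M π → Σ (Path M) λ π' → Extends M π' π × StrongHyperfair M B π'
proposition38 M B π (n , eq) =
  let (ρ , fair) = hyperfair-path B (act π 0) (st π n)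
  in proj₁ (append π eq ρ) , append-extends π eq ρ , append-hyperfair π eq ρ fair
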